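{- Let $E=(E^+,E^-)$ be an example set with $E^+=\{\mathcal D_i\mid i\in I^+\}$ and $E^-=\{\mathcal D_i\mid i\in I^-\}$ ($I^+,I^-$ disjoint, $I^+=\{1,\dots,l\}$), let $\Sigma$ be the set of atoms occurring in $E$, $\Sigma^\bot=\Sigma\cup\{\bot\}$, let $\mathfrak P$ be the product of the transition systems $S^i$, $i\in I^+$, and $\mathfrak N$ the disjoint union of the $S^i$, $i\in I^-$ (all defined below). Then (i) $E$ is not $\mathcal Q[\mathcal U_s]$-separable iff $\mathfrak P$ is simulated by $\mathfrak N$; (ii) $E$ is not $\mathcal Q_p[\mathcal U]$-separable iff $\mathfrak P$ is contained in $\mathfrak N$.
   Context: Strict semantics of LTL over $\mathbb N$: $\mathcal I,n\models\varphi\,\mathcal U\,\psi$ iff there is $m>n$ with $\mathcal I,m\models\psi$ and $\mathcal I,k\models\varphi$ for all $n<k<m$. A data instance is a finite set of facts $A(\ell)$, $\ell\in\mathbb N$, with maximal timestamp $\max\mathcal D$; $\mathcal D\models\varkappa(0)$ means $\mathcal I,0\models\varkappa$ in every interpretation $\mathcal I$ making all facts of $\mathcal D$ true. $\mathcal Q[\mathcal U]$: queries built from atoms, $\top,\bot$ with $\wedge$ and $\mathcal U$. $\mathcal Q[\mathcal U_s]$: $\mathcal Q[\mathcal U]$-queries with no subquery $\varkappa_1\,\mathcal U\,\varkappa_2$ where $\mathcal U$ occurs in $\varkappa_1$. $\mathcal Q_p[\mathcal U]$: queries $\rho_0\wedge(\lambda_1\,\mathcal U\,(\rho_1\wedge(\lambda_2\,\mathcal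 U\,(\dots(\lambda_n\,\mathcal U\,\rho_n)\dots))))$ with $\rho_i$ conjunctions of atoms and each $\lambda_i$ a conjunction of atoms or $\bot$. $E$ is $\mathcal Q$-separable if some $\varkappa\in\mathcal Q$ satisfies $\mathcal D\models\varkappa(0)$ for all $\mathcal D\in E^+$ and $\mathcal D\not\models\varkappa(0)$ for all $\mathcal D\in E^-$. A transition system consists of a set of states, each labelled by a subset of $\Sigma$, a set of directed transitions between states, each labelled by a subset of $\Sigma^\bot$, and a set of start states. A run is a finite path $s_0\to s_1\to\dots\to s_n$ ($n\ge0$) with $s_0$ a start state, together with its labels. The computation tree $\mathfrak T_S$ has the runs of $S$ as nodes, the runs of length $0$ as roots, and an edge from $s_0\to\dots\to s_n$ to $s_0\to\dots\to s_n\to s_{n+1}$, with node label that of the last state and edge label that of the last transition. $S$ is contained in $S'$ if for every run $r$ of $S$ there is a run $r'$ of $S'$ of the same length such that each state label and each transition label of $r$ is a subset of the corresponding label in $r'$. $S$ is simulated by $S'$ if every finite subtree of $\mathfrak T_S$ (a finite set of nodes containing a root and closed under taking prefixes) has a homomorphism into $\mathfrak T_{S'}$, i.e. a map sending the root to a root, edges to edges, and such that each node label and edge label is a subset of the label of the image. For $i\in I^+\cup I^-$ with $M_i=\max\mathcal D_i$, $S^i$ has states $0,\dots,M_i+1$ with single start state $0$; state $j\le M_i$ is labelled $\{A\mid A(j)\in\mathcal D_i\}$ and $M_i+1$ is labelled $\emptyset$; for all $0\le j<k\le M_i+1$ there is a transition $j\to k$ labelled $\{A\in\Sigma^\bot\mid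 A(n)\in\mathcal D_i\text{ for all } n \text{ with } j<n<k\}$ (so it contains $\bot$ iff $k=j+1$), and a loop $M_i+1\to M_i+1$ labelled $\Sigma^\bot$. The product $\mathfrak P$ has as states tuples $(s_1,\dots,s_l)$ of states of $S^1,\dots,S^l$, start state the tuple of start states, state labels the intersection of component labels, and a transition $(s_1,\dots,s_l)\to(p_1,\dots,p_l)$ iff $s_i\to p_i$ in $S^i$ for all $i$, labelled by the intersection of the component transition labels. $\mathfrak N$ is the disjoint union of the $S^i$, $i\in I^-$, with the union of their start states. -}

module Defs where

open import Level using (0ℓ)
open import Data.Nat using (ℕ; zero; suc; _<_; _≤_; _⊔_)
open import Data.Fin using (Fin; toℕ; fromℕ)
open import Data.Bool using (Bool; true)
open import Data.Maybe using (Maybe; just; nothing)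
open import Data.List using (List; foldr)
open import Data.List.Membership.Propositional using (_∈_)
open import Data.Product using (Σ; ∃; ∃-syntax; Σ-syntax; _×_; _,_; proj₁; proj₂)
open import Data.Sum using (_⊎_)
open import Data.Unit using (⊤)
open import Data.Empty using (⊥)
open import Relation.Nullary using (¬_)
open import Relation.Binary.PropositionalEquality using (_≡_)

Atom : Set
Atom = ℕ

-- A fact A(ℓ) is the pair (A , ℓ); a data instance is a finite set of
-- facts, represented by a list.
Fact : Set
Fact = Atom × ℕ

Instance : Set
Instance = List Fact

-- maximal timestamp max D (0 for the empty instance)
maxD : Instance → ℕ
maxD = foldr (λ f m → proj₂ f ⊔ m) 0

data Query : Set where
  atom : Atom → Query
  tt   : Query
  ff   : Query
  _∧_  : Query → Query → Query
  _U_  : Query → Query → Query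

Interp : Set
Interp = Atom → ℕ → Bool

Sat : Interp → ℕ → Query → Set
Sat I n (atom A) = I A n ≡ true
Sat I n tt = ⊤
Sat I n ff = ⊥
Sat I n (φ ∧ ψ) = Sat I n φ × Sat I n ψ
Sat I n (φ U ψ) = ∃[ m ] (n < m × Sat I m ψ × (∀ k → n < k → k < m → Sat I k φ))

_⊨0_ : Instance → Query → Set
D ⊨0 κ = (I : Interp) → (∀ A t → (A , t) ∈ D → I A t ≡ true) → Sat I 0 κ

data UFree : Query → Set where
  atom : ∀ A → UFree (atom A)
  tt   : UFree tt
  ff   : UFree ff
  _∧_  : ∀ {φ ψ} → UFree φ → UFree ψ → UFree (φ ∧ ψ)

data InQUs : Query → Set where
  atom : ∀ A → InQUs (atom A)
  tt   : InQUs tt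
  ff   : InQUs ff
  _∧_  : ∀ {φ ψ} → InQUs φ → InQUs ψ → InQUs (φ ∧ ψ)
  _U_  : ∀ {φ ψ} → UFree φ → InQUs ψ → InQUs (φ U ψ)

data ConjAtoms : Query → Set where
  atom : ∀ A → ConjAtoms (atom A)
  tt   : ConjAtoms tt
  _∧_  : ∀ {φ ψ} → ConjAtoms φ → ConjAtoms ψ → ConjAtoms (φ ∧ ψ)

data IsLambda : Query → Set where
  conj : ∀ {φ} → ConjAtoms φ → IsLambda φ
  ff   : IsLambda ff

data InQp : Query → Set where
  last : ∀ {ρ} → ConjAtoms ρ → InQp ρ
  step : ∀ {ρ λ' κ} → ConjAtoms ρ → IsLambda λ' → InQp κ → InQp (ρ ∧ (λ' U κ))

-- separability of E = (E⁺, E⁻), I⁺ = {1..l} ≅ Fin l, I⁻ ≅ Fin m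
Separable : (Query → Set) → ∀ {l m} → (Fin l → Instance) → (Fin m → Instance) → Set
Separable Cls Epos Eneg =
  ∃[ κ ] (Cls κ × (∀ i → Epos i ⊨0 κ) × (∀ j → ¬ (Eneg j ⊨0 κ)))

-- labels: subsets of Σ^⊥, with nothing standing for ⊥ and just A for A
Label : Set₁
Label = Maybe Atom → Set

_⊆L_ : Label → Label → Set
L ⊆L L' = ∀ x → L x → L' x

record TS : Set₁ where
  field
    State : Set
    Start : State → Set
    slab  : State → Label
    Trans : State → State → Set
    tlab  : ∀ {s s'} → Trans s s' → Label
open TS public

data Run (S : TS) : State S → Set where
  root : ∀ {s} → Start S s → Run S s
  step : ∀ {s s'} → Run S s → Trans S s s' → Run S s'

data RunLeq (S S' : TS) : ∀ {s s'} → Run S s → Run S' s' → Set where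
  root : ∀ {s s'} {p : Start S s} {p' : Start S' s'} →
         slab S s ⊆L slab S' s' → RunLeq S S' (root p) (root p')
  step : ∀ {s s' u u'} {r : Run S s} {r' : Run S' s'}
           {t : Trans S s u} {t' : Trans S' s' u'} →
         RunLeq S S' r r' → tlab S t ⊆L tlab S' t' → slab S u ⊆L slab S' u' →
         RunLeq S S' (step r t) (step r' t')

ContainedIn : TS → TS → Set
ContainedIn S S' = ∀ s (r : Run S s) → ∃[ s' ] Σ[ r' ∈ Run S' s' ] RunLeq S S' r r'

-- computation tree 𝔗_S: nodes, roots, edges, labels
Node : TS → Set
Node S = Σ[ s ∈ State S ] Run S s

nlab : (S : TS) → Node S → Label
nlab S (s , _) = slab S s

data IsRoot (S : TS) : Node S → Set where
  isRoot : ∀ {s} (p : Start S s) → IsRoot S (s , root p)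

data Edge (S : TS) : Node S → Node S → Set where
  edge : ∀ {s s'} (r : Run S s) (t : Trans S s s') → Edge S (s , r) (s' , step r t)

elab : (S : TS) → ∀ {n n'} → Edge S n n' → Label
elab S (edge r t) = tlab S t

record FiniteSubtree (S : TS) : Set₁ where
  field
    nodes      : List (Node S)
    hasRoot    : ∃[ n ] (n ∈ nodes × IsRoot S n)
    prefClosed : ∀ {n n'} → n' ∈ nodes → Edge S n n' → n ∈ nodes

record Hom (S S' : TS) (T : FiniteSubtree S) : Set₁ where
  open FiniteSubtree T
  field
    h       : Node S → Node S'
    roots   : ∀ {n} → n ∈ nodes → IsRoot S n → IsRoot S' (h n)
    nlabels : ∀ {n} → n ∈ nodes → nlab S n ⊆L nlab S' (h n)
    edges   : ∀ {n n'} → n ∈ nodes → n' ∈ nodes → (e : Edge S n n') →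
              Σ[ e' ∈ Edge S' (h n) (h n') ] (elab S e ⊆L elab S' e')

SimulatedBy : TS → TS → Set₁
SimulatedBy S S' = (T : FiniteSubtree S) → Hom S S' T

InΣ⊥ : (Atom → Set) → Label
InΣ⊥ Sig nothing  = ⊤
InΣ⊥ Sig (just A) = Sig A

HasFact : Instance → Maybe Atom → ℕ → Set
HasFact D nothing  n = ⊥
HasFact D (just A) n = (A , n) ∈ D

data STrans (M : ℕ) : Fin (suc (suc M)) → Fin (suc (suc M)) → Set where
  fwd  : ∀ {j k} → toℕ j < toℕ k → STrans M j k
  loop : STrans M (fromℕ (suc M)) (fromℕ (suc M))

SD : (Atom → Set) → Instance → TS
SD Sig D = record
  { State = Fin (suc (suc (maxD D)))
  ; Start = λ j → j ≡ Fin.zero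
  ; slab  = λ j x → toℕ j ≤ maxD D × Σ[ A ∈ Atom ] (x ≡ just A × (A , toℕ j) ∈ D)
  ; Trans = STrans (maxD D)
  ; tlab  = tl
  }
  where
  import Data.Fin as Fin
  tl : ∀ {j k} → STrans (maxD D) j k → Label
  tl {j} {k} (fwd _) x = InΣ⊥ Sig x × (∀ n → toℕ j < n → n < toℕ k → HasFact D x n)
  tl loop x = InΣ⊥ Sig x

Product : ∀ {l} → (Fin l → TS) → TS
Product {l} S = record
  { State = (i : Fin l) → State (S i)
  ; Start = λ s → ∀ i → Start (S i) (s i)
  ; slab  = λ s x → ∀ i → slab (S i) (s i) x
  ; Trans = λ s p → ∀ i → Trans (S i) (s i) (p i)
  ; tlab  = λ t x → ∀ i → tlab (S i) (t i) x
  }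

data UTrans {m} (S : Fin m → TS) : Σ (Fin m) (λ i → State (S i)) →
                                    Σ (Fin m) (λ i → State (S i)) → Set where
  inj : ∀ i {s s'} → Trans (S i) s s' → UTrans S (i , s) (i , s')

utlab : ∀ {m} (S : Fin m → TS) {u u'} → UTrans S u u' → Label
utlab S (inj i t) = tlab (S i) t

DisjUnion : ∀ {m} → (Fin m → TS) → TS
DisjUnion {m} S = record
  { State = Σ (Fin m) (λ i → State (S i))
  ; Start = λ u → Start (S (proj₁ u)) (proj₂ u)
  ; slab  = λ u → slab (S (proj₁ u)) (proj₂ u)
  ; Trans = UTrans S
  ; tlab  = utlab S
  }

SigmaE : ∀ {l m} → (Fin l → Instance) → (Fin m → Instance) → Atom → Set
SigmaE Epos Eneg A = (∃[ i ] ∃[ t ] ((A , t) ∈ Epos i)) ⊎ (∃[ j ] ∃[ t ] ((A , t) ∈ Eneg j))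

𝔓 : ∀ {l m} → (Fin l → Instance) → (Fin m → Instance) → TS
𝔓 Epos Eneg = Product (λ i → SD (SigmaE Epos Eneg) (Epos i))

𝔑 : ∀ {l m} → (Fin l → Instance) → (Fin m → Instance) → TS
𝔑 Epos Eneg = DisjUnion (λ j → SD (SigmaE Epos Eneg) (Eneg j))

-- A Q[U_s]-query holds at the start of S^D exactly when D entails it: the states of S^D are the
-- time points of D, with everything after max D collapsed into a sink, and a transition label
-- records what holds at every point strictly in between (⊥ meaning that there is no such point).
-- Hence a query holds at the start of 𝔓 iff all positive examples entail it, and at a start of 𝔑
-- iff some negative example does.  Homomorphisms of finite subtrees preserve Q[U_s]-queries and
-- dominating runs preserve Q_p[U]-queries, which gives one direction of (i) and of (ii).
-- Conversely, a finite subtree T of the computation tree of 𝔓 is described by the unfolding of 𝔓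
-- to the height of T over the states of T, and a run of 𝔓 by its path query, listing the labels
-- of its states and transitions.  Both queries hold in 𝔓, so without a separating query some
-- negative example entails them, and their witnesses in 𝔑 yield a homomorphic image of T, resp.
-- a run dominating the given one.

module Submission where

open import Data.Bool using (true)
open import Data.Empty using (⊥; ⊥-elim)
open import Data.Fin using (Fin; toℕ; fromℕ; fromℕ<)
import Data.Fin as Fin
import Data.Fin.Properties as Fin
open import Data.List using (List; []; _∷_; _++_; map; concatMap; filter; allFin)
open import Data.List.Extrema.Nat using (max; xs≤max)
open import Data.List.Membership.Propositional using (_∈_)
open import Data.List.Membership.Propositional.Properties
  using (∈-++⁻; ∈-++⁺ˡ; ∈-++⁺ʳ; ∈-map⁺; ∈-map⁻; ∈-concatMap⁺; ∈-concatMap⁻; ∈-allFin;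
         ∈-filter⁺; ∈-filter⁻)
open import Data.List.Relation.Binary.Subset.Propositional using (_⊆_)
open import Data.List.Relation.Binary.Subset.Propositional.Properties
  using (∷⁺ʳ; xs⊆xs++ys; xs⊆ys++xs)
open import Data.List.Relation.Unary.All as All using (All; []; _∷_)
import Data.List.Relation.Unary.All.Properties as All
open import Data.List.Relation.Unary.Any as Any using (here; there)
open import Data.Maybe using (Maybe; just; nothing)
open import Data.Nat using (ℕ; zero; suc; _∸_; _<_; _≤_; _<?_; _≤?_; s≤s; z≤n)
import Data.Nat.Properties as ℕ
open import Data.Product using (Σ-syntax; ∃-syntax; _×_; _,_; proj₁; proj₂)
import Data.Product.Properties as Product
open import Data.Sum using (inj₁; inj₂)
open import Data.Unit using (⊤; tt)
open import Function using (_∘_)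
open import Function.Bundles using (_⇔_; mk⇔; module Equivalence)
open import Relation.Binary.PropositionalEquality using (_≡_; refl; sym; trans; cong; subst)
open import Relation.Nullary using (¬_; Dec; yes; no; does; contradiction)
open import Relation.Nullary.Decidable using (dec-true; map′; ¬?; _×-dec_; _→-dec_)
open import Relation.Unary using (Decidable)

open import Defs
open import Data.List.Membership.DecPropositional (Product.≡-dec ℕ._≟_ ℕ._≟_) using (_∈?_)

-- Meaningful for U-free queries only: an until contributes no conjunct.
conjuncts : Query → List (Maybe Atom)
conjuncts (atom A) = just A ∷ []
conjuncts ff       = nothing ∷ []
conjuncts (φ ∧ ψ)  = conjuncts φ ++ conjuncts ψ
conjuncts tt       = []
conjuncts (φ U ψ)  = []

⋀ : ∀ {X : Set} → (X → Query) → List X → Query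
⋀ f []       = tt
⋀ f (x ∷ xs) = f x ∧ ⋀ f xs

TrueAt : Interp → Maybe Atom → ℕ → Set
TrueAt I nothing  n = ⊥
TrueAt I (just A) n = I A n ≡ true

Sat-UFree⁻ : ∀ {I n φ} → UFree φ → Sat I n φ → All (λ x → TrueAt I x n) (conjuncts φ)
Sat-UFree⁻ (atom A) w         = w ∷ []
Sat-UFree⁻ tt       w         = []
Sat-UFree⁻ (u ∧ v)  (wφ , wψ) = All.++⁺ (Sat-UFree⁻ u wφ) (Sat-UFree⁻ v wψ)

Sat-UFree⁺ : ∀ {I n φ} → UFree φ → All (λ x → TrueAt I x n) (conjuncts φ) → Sat I n φ
Sat-UFree⁺ (atom A) (w ∷ []) = w
Sat-UFree⁺ tt       []       = tt
Sat-UFree⁺ ff       (() ∷ [])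
Sat-UFree⁺ {φ = φ ∧ ψ} (u ∧ v) w =
  let wφ , wψ = All.++⁻ (conjuncts φ) w in Sat-UFree⁺ u wφ , Sat-UFree⁺ v wψ

UFree⇒InQUs : ∀ {φ} → UFree φ → InQUs φ
UFree⇒InQUs (atom A) = atom A
UFree⇒InQUs tt       = tt
UFree⇒InQUs ff       = ff
UFree⇒InQUs (u ∧ v)  = UFree⇒InQUs u ∧ UFree⇒InQUs v

ConjAtoms⇒UFree : ∀ {φ} → ConjAtoms φ → UFree φ
ConjAtoms⇒UFree (atom A) = atom A
ConjAtoms⇒UFree tt       = tt
ConjAtoms⇒UFree (c ∧ d)  = ConjAtoms⇒UFree c ∧ ConjAtoms⇒UFree d

IsLambda⇒UFree : ∀ {φ} → IsLambda φ → UFree φ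
IsLambda⇒UFree (conj c) = ConjAtoms⇒UFree c
IsLambda⇒UFree ff       = ff

InQp⇒InQUs : ∀ {κ} → InQp κ → InQUs κ
InQp⇒InQUs (last c)       = UFree⇒InQUs (ConjAtoms⇒UFree c)
InQp⇒InQUs (step c lam q) = UFree⇒InQUs (ConjAtoms⇒UFree c) ∧ (IsLambda⇒UFree lam U InQp⇒InQUs q)

InQUs-⋀ : ∀ {X : Set} (f : X → Query) xs → (∀ x → InQUs (f x)) → InQUs (⋀ f xs)
InQUs-⋀ f []       q = tt
InQUs-⋀ f (x ∷ xs) q = q x ∧ InQUs-⋀ f xs q

⊨0-⋀ : ∀ {X : Set} {D} (f : X → Query) xs → (∀ {x} → x ∈ xs → D ⊨0 f x) → D ⊨0 ⋀ f xs
⊨0-⋀ f []       ents I model = tt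
⊨0-⋀ f (x ∷ xs) ents I model = ents (here refl) I model , ⊨0-⋀ f xs (ents ∘ there) I model

ConjAtoms-⋀atom : ∀ as → ConjAtoms (⋀ atom as)
ConjAtoms-⋀atom []       = tt
ConjAtoms-⋀atom (A ∷ as) = atom A ∧ ConjAtoms-⋀atom as

conjuncts-⋀atom⁺ : ∀ {P : Maybe Atom → Set} as → All (P ∘ just) as → All P (conjuncts (⋀ atom as))
conjuncts-⋀atom⁺ []       []       = []
conjuncts-⋀atom⁺ (A ∷ as) (p ∷ ps) = p ∷ conjuncts-⋀atom⁺ as ps

conjuncts-⋀atom⁻ : ∀ {P : Maybe Atom → Set} as → All P (conjuncts (⋀ atom as)) → All (P ∘ just) as
conjuncts-⋀atom⁻ []       []       = []
conjuncts-⋀atom⁻ (A ∷ as) (p ∷ ps) = p ∷ conjuncts-⋀atom⁻ as ps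

∀-between? : (Q : ℕ → Set) → Decidable Q → ∀ a b → Dec (∀ n → a < n → n < b → Q n)
∀-between? Q Q? a b = map′ to from (Fin.all? λ (i : Fin b) → (a <? toℕ i) →-dec Q? (toℕ i))
  where
  to : (∀ i → a < toℕ i → Q (toℕ i)) → ∀ n → a < n → n < b → Q n
  to h n a<n n<b = subst Q (Fin.toℕ-fromℕ< n<b)
                     (h (fromℕ< n<b) (subst (a <_) (sym (Fin.toℕ-fromℕ< n<b)) a<n))
  from : (∀ n → a < n → n < b → Q n) → ∀ i → a < toℕ i → Q (toℕ i)
  from h i a<i = h (toℕ i) a<i (Fin.toℕ<n i)

∸-suc : ∀ {m n} → n < m → m ∸ n ≡ suc (m ∸ suc n)
∸-suc {suc m} {zero}  _         = refl
∸-suc {suc m} {suc n} (s≤s n<m) = ∸-suc n<m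

∈⇒≤maxD : ∀ {A t} D → (A , t) ∈ D → t ≤ maxD D
∈⇒≤maxD (_ ∷ D) (here refl) = ℕ.m≤m⊔n _ (maxD D)
∈⇒≤maxD (_ ∷ D) (there A∈)  = ℕ.≤-trans (∈⇒≤maxD D A∈) (ℕ.m≤n⊔m _ (maxD D))

atomsOf : ∀ {n} → (Fin n → Instance) → List Atom
atomsOf E = concatMap (map proj₁ ∘ E) (allFin _)

∈atomsOf⁺ : ∀ {n} (E : Fin n → Instance) {i A t} → (A , t) ∈ E i → A ∈ atomsOf E
∈atomsOf⁺ E {i} A∈ =
  ∈-concatMap⁺ (map proj₁ ∘ E) (Any.map (λ { refl → ∈-map⁺ proj₁ A∈ }) (∈-allFin i))

∈atomsOf⁻ : ∀ {n} (E : Fin n → Instance) {A} → A ∈ atomsOf E → ∃[ i ] ∃[ t ] ((A , t) ∈ E i)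
∈atomsOf⁻ E A∈ with Any.satisfied (∈-concatMap⁻ (map proj₁ ∘ E) {xs = allFin _} A∈)
... | i , A∈Ei with ∈-map⁻ proj₁ A∈Ei
...   | (_ , t) , fact∈ , refl = i , t , fact∈

initial : ∀ {S : TS} {s} → Run S s → State S
initial {s = s} (root _) = s
initial (step r _)       = initial r

initial-start : ∀ {S : TS} {s} (r : Run S s) → Start S (initial r)
initial-start (root start) = start
initial-start (step r _)   = initial-start r

depth : ∀ {S : TS} {s} → Run S s → ℕ
depth (root _)   = 0
depth (step r _) = suc (depth r)

RunLeq-end : ∀ {S S' : TS} {s s'} {r : Run S s} {r' : Run S' s'} →
             RunLeq S S' r r' → slab S s ⊆L slab S' s'
RunLeq-end (root sub)     = sub
RunLeq-end (step _ _ sub) = sub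

IsRoot⇒Start : ∀ {S : TS} {n} → IsRoot S n → Start S (proj₁ n)
IsRoot⇒Start (isRoot start) = start

module Semantics (Sig : Atom → Set) where

  Supported : Maybe Atom → Set
  Supported nothing  = ⊥
  Supported (just A) = Sig A

  -- A U-free φ fits a transition label L when it holds at every point strictly inside the
  -- transition: ⊥ ∈ L records that there is no such point, and only then can a φ mentioning
  -- ⊥ or an atom outside Σ hold.  Splitting on the conjuncts of φ rather than on ⊥ ∈ L makes
  -- the notion stable under intersections of labels.
  Fits : Query → Label → Set
  Fits φ L = (All Supported (conjuncts φ) → All L (conjuncts φ))
           × (¬ All Supported (conjuncts φ) → L nothing)

  Holds : (S : TS) → State S → Query → Set
  Holds S s (atom A) = slab S s (just A)
  Holds S s tt       = ⊤
  Holds S s ff       = ⊥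
  Holds S s (φ ∧ ψ)  = Holds S s φ × Holds S s ψ
  Holds S s (φ U ψ)  = ∃[ s' ] Σ[ t ∈ Trans S s s' ] (Fits φ (tlab S t) × Holds S s' ψ)

  Fits-mono : ∀ φ {L L'} → L ⊆L L' → Fits φ L → Fits φ L'
  Fits-mono φ L⊆L' (fits , vacuous) =
    (λ sup → All.map (λ {x} → L⊆L' x) (fits sup)) , (λ unsup → L⊆L' nothing (vacuous unsup))

  Fits-⋂ : ∀ φ {l} (L : Fin l → Label) → (∀ i → Fits φ (L i)) → Fits φ (λ x → ∀ i → L i x)
  Fits-⋂ φ L fits =
    (λ sup → All.tabulate λ x∈ i → All.lookup (proj₁ (fits i) sup) x∈) ,
    (λ unsup i → proj₂ (fits i) unsup)

  Holds-ConjAtoms : ∀ {S S' : TS} {s s' φ} → ConjAtoms φ →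
                    slab S s ⊆L slab S' s' → Holds S s φ → Holds S' s' φ
  Holds-ConjAtoms (atom A) sub w         = sub (just A) w
  Holds-ConjAtoms tt       sub w         = tt
  Holds-ConjAtoms (c ∧ d)  sub (wc , wd) = Holds-ConjAtoms c sub wc , Holds-ConjAtoms d sub wd

  Holds-⋀⁺ : ∀ {X : Set} {S : TS} {s} (f : X → Query) xs →
             (∀ {x} → x ∈ xs → Holds S s (f x)) → Holds S s (⋀ f xs)
  Holds-⋀⁺ f []       w = tt
  Holds-⋀⁺ f (x ∷ xs) w = w (here refl) , Holds-⋀⁺ f xs (w ∘ there)

  Holds-⋀⁻ : ∀ {X : Set} {S : TS} {s} (f : X → Query) xs →
             Holds S s (⋀ f xs) → ∀ {x} → x ∈ xs → Holds S s (f x)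
  Holds-⋀⁻ f (x ∷ xs) (w , ws) (here refl) = w
  Holds-⋀⁻ f (x ∷ xs) (w , ws) (there x∈)  = Holds-⋀⁻ f xs ws x∈

  Holds-Product⁻ : ∀ {l} (S : Fin l → TS) s κ → Holds (Product S) s κ → ∀ i → Holds (S i) (s i) κ
  Holds-Product⁻ S s (atom A) w         i = w i
  Holds-Product⁻ S s tt       w         i = tt
  Holds-Product⁻ S s (φ ∧ ψ)  (wφ , wψ) i = Holds-Product⁻ S s φ wφ i , Holds-Product⁻ S s ψ wψ i
  Holds-Product⁻ S s (φ U ψ)  (s' , t , fits , w) i =
    s' i , t i , Fits-mono φ (λ x inAll → inAll i) fits , Holds-Product⁻ S s' ψ w i

  -- For an empty product every component vacuously satisfies ⊥, the product does not.
  Holds-Product⁺ : ∀ {l} (S : Fin (suc l) → TS) s κ →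
                   (∀ i → Holds (S i) (s i) κ) → Holds (Product S) s κ
  Holds-Product⁺ S s (atom A) w = w
  Holds-Product⁺ S s tt       w = tt
  Holds-Product⁺ S s ff       w = w Fin.zero
  Holds-Product⁺ S s (φ ∧ ψ)  w =
    Holds-Product⁺ S s φ (λ i → proj₁ (w i)) , Holds-Product⁺ S s ψ (λ i → proj₂ (w i))
  Holds-Product⁺ S s (φ U ψ)  w =
    (λ i → proj₁ (w i)) , (λ i → proj₁ (proj₂ (w i))) ,
    Fits-⋂ φ _ (λ i → proj₁ (proj₂ (proj₂ (w i)))) ,
    Holds-Product⁺ S _ ψ (λ i → proj₂ (proj₂ (proj₂ (w i))))

  Holds-DisjUnion⁺ : ∀ {m} (S : Fin m → TS) j s κ → Holds (S j) s κ → Holds (DisjUnion S) (j , s) κ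
  Holds-DisjUnion⁺ S j s (atom A) w         = w
  Holds-DisjUnion⁺ S j s tt       w         = tt
  Holds-DisjUnion⁺ S j s (φ ∧ ψ)  (wφ , wψ) = Holds-DisjUnion⁺ S j s φ wφ , Holds-DisjUnion⁺ S j s ψ wψ
  Holds-DisjUnion⁺ S j s (φ U ψ)  (s' , t , fits , w) =
    (j , s') , inj j t , fits , Holds-DisjUnion⁺ S j s' ψ w

  Holds-DisjUnion⁻ : ∀ {m} (S : Fin m → TS) j s κ → Holds (DisjUnion S) (j , s) κ → Holds (S j) s κ
  Holds-DisjUnion⁻ S j s (atom A) w         = w
  Holds-DisjUnion⁻ S j s tt       w         = tt
  Holds-DisjUnion⁻ S j s (φ ∧ ψ)  (wφ , wψ) = Holds-DisjUnion⁻ S j s φ wφ , Holds-DisjUnion⁻ S j s ψ wψ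
  Holds-DisjUnion⁻ S j s (φ U ψ)  ((.j , s') , inj .j t , fits , w) =
    s' , t , fits , Holds-DisjUnion⁻ S j s' ψ w

  module _ (S : TS) where

    below : ∀ {s} (r : Run S s) κ → Holds S s κ → List (Node S)
    below r (atom A) w                = []
    below r tt       w                = []
    below r (φ ∧ ψ)  (wφ , wψ)        = below r φ wφ ++ below r ψ wψ
    below r (φ U ψ)  (s' , t , _ , w) = (s' , step r t) ∷ below (step r t) ψ w

    witness : ∀ {s} (r : Run S s) κ → Holds S s κ → List (Node S)
    witness {s} r κ w = (s , r) ∷ below r κ w

    below-parent : ∀ {s} (r : Run S s) κ w {n'} → n' ∈ below r κ w →
                   ∃[ n ] (n ∈ witness r κ w × Edge S n n')
    below-parent r (φ ∧ ψ) (wφ , wψ) n'∈ with ∈-++⁻ (below r φ wφ) n'∈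
    ... | inj₁ n'∈φ = let n , n∈ , e = below-parent r φ wφ n'∈φ
                      in n , ∷⁺ʳ _ (xs⊆xs++ys _ _) n∈ , e
    ... | inj₂ n'∈ψ = let n , n∈ , e = below-parent r ψ wψ n'∈ψ
                      in n , ∷⁺ʳ _ (xs⊆ys++xs _ (below r φ wφ)) n∈ , e
    below-parent r (φ U ψ) (s' , t , _ , w) (here refl) = _ , here refl , edge r t
    below-parent r (φ U ψ) (s' , t , _ , w) (there n'∈) =
      let n , n∈ , e = below-parent (step r t) ψ w n'∈ in n , there n∈ , e

    edge-source : ∀ {n m n'} → Edge S n n' → Edge S m n' → n ≡ m
    edge-source (edge r t) (edge .r .t) = refl

    edge-transition : ∀ {n n'} (e : Edge S n n') →
                      Σ[ t ∈ Trans S (proj₁ n) (proj₁ n') ] (elab S e ⊆L tlab S t)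
    edge-transition (edge r t) = t , λ x l → l

    witnessTree : ∀ {s} (p : Start S s) κ → Holds S s κ → FiniteSubtree S
    witnessTree p κ w = record
      { nodes      = witness (root p) κ w
      ; hasRoot    = _ , here refl , isRoot p
      ; prefClosed = closed
      }
      where
      closed : ∀ {n n'} → n' ∈ witness (root p) κ w → Edge S n n' → n ∈ witness (root p) κ w
      closed (here refl) ()
      closed (there n'∈) e =
        let m , m∈ , e' = below-parent (root p) κ w n'∈ in subst (_∈ _) (edge-source e' e) m∈

  Hom-Holds : ∀ {S S'} {T : FiniteSubtree S} (hom : Hom S S' T) {s} (r : Run S s) κ
              (w : Holds S s κ) → witness S r κ w ⊆ FiniteSubtree.nodes T →
              Holds S' (proj₁ (Hom.h hom (s , r))) κ
  Hom-Holds hom r (atom A) w         inT = Hom.nlabels hom (inT (here refl)) (just A) w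
  Hom-Holds hom r tt       w         inT = tt
  Hom-Holds {S} hom r (φ ∧ ψ) (wφ , wψ) inT =
    Hom-Holds hom r φ wφ (inT ∘ ∷⁺ʳ _ (xs⊆xs++ys _ _)) ,
    Hom-Holds hom r ψ wψ (inT ∘ ∷⁺ʳ _ (xs⊆ys++xs _ (below S r φ wφ)))
  Hom-Holds {S} {S'} hom r (φ U ψ) (s' , t , fits , w) inT =
    let e' , sub  = Hom.edges hom (inT (here refl)) (inT (there (here refl))) (edge r t)
        t' , sub' = edge-transition S' e'
    in _ , t' , Fits-mono φ (λ x l → sub' x (sub x l)) fits ,
       Hom-Holds hom (step r t) ψ w (inT ∘ there)

module InstanceSystem (Sig : Atom → Set) (Sig? : Decidable Sig) (D : Instance)
                      (D⊆Σ : ∀ {A t} → (A , t) ∈ D → Sig A) where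
  open Semantics Sig

  M : ℕ
  M = maxD D

  𝕊 : TS
  𝕊 = SD Sig D

  St : Set
  St = State 𝕊

  top : St
  top = fromℕ (suc M)

  Model : Interp → Set
  Model I = ∀ A t → (A , t) ∈ D → I A t ≡ true

  minimal : Interp
  minimal A t = does ((A , t) ∈? D)

  minimal-model : Model minimal
  minimal-model A t A∈ = dec-true ((A , t) ∈? D) A∈

  minimal-true : ∀ {A t} → minimal A t ≡ true → (A , t) ∈ D
  minimal-true {A} {t} eq with (A , t) ∈? D | eq
  ... | yes A∈ | _ = A∈
  ... | no _   | ()

  Supported? : Decidable Supported
  Supported? nothing  = no λ ()
  Supported? (just A) = Sig? A

  Supported⇒InΣ⊥ : ∀ {x} → Supported x → InΣ⊥ Sig x
  Supported⇒InΣ⊥ {just A} sup = sup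

  HasFact⇒Supported : ∀ {x n} → HasFact D x n → Supported x
  HasFact⇒Supported {just A} A∈ = D⊆Σ A∈

  HasFact⇒TrueAt : ∀ {I x n} → Model I → HasFact D x n → TrueAt I x n
  HasFact⇒TrueAt {x = just A} model A∈ = model A _ A∈

  TrueAt-minimal : ∀ {x n} → TrueAt minimal x n → HasFact D x n
  TrueAt-minimal {just A} = minimal-true

  data Tracks (s : St) (t : ℕ) : Set where
    early : toℕ s ≡ t → t ≤ M → Tracks s t
    late  : s ≡ top → M < t → Tracks s t

  toℕ-top : toℕ top ≡ suc M
  toℕ-top = Fin.toℕ-fromℕ (suc M)

  tracks-toℕ : ∀ s → Tracks s (toℕ s)
  tracks-toℕ s with ℕ.m≤n⇒m<n∨m≡n (Fin.toℕ≤pred[n] s)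
  ... | inj₁ s<top = early refl (ℕ.≤-pred s<top)
  ... | inj₂ s≡top = late (Fin.toℕ-injective (trans s≡top (sym toℕ-top)))
                          (subst (M <_) (sym s≡top) (ℕ.n<1+n M))

  clamp : ℕ → St
  clamp t with t ≤? M
  ... | yes t≤M = fromℕ< (s≤s (ℕ.m≤n⇒m≤1+n t≤M))
  ... | no _    = top

  tracks-clamp : ∀ t → Tracks (clamp t) t
  tracks-clamp t with t ≤? M
  ... | yes t≤M = early (Fin.toℕ-fromℕ< (s≤s (ℕ.m≤n⇒m≤1+n t≤M))) t≤M
  ... | no t≰M  = late refl (ℕ.≰⇒> t≰M)

  Between : ℕ → ℕ → Label
  Between a b x = InΣ⊥ Sig x × (∀ n → a < n → n < b → HasFact D x n)

  Fits-Between⁺ : ∀ {φ a b} → (∀ n → a < n → n < b → All (λ x → HasFact D x n) (conjuncts φ)) →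
                  Fits φ (Between a b)
  Fits-Between⁺ facts =
    (λ sup → All.tabulate λ {x} x∈ → Supported⇒InΣ⊥ {x} (All.lookup sup x∈) ,
                                 λ n a<n n<b → All.lookup (facts n a<n n<b) x∈) ,
    (λ unsup → tt , λ n a<n n<b → contradiction (All.map HasFact⇒Supported (facts n a<n n<b)) unsup)

  Fits-Between⁻ : ∀ {φ a b n} → Fits φ (Between a b) → a < n → n < b →
                  All (λ x → HasFact D x n) (conjuncts φ)
  Fits-Between⁻ {φ} {n = n} (fits , vacuous) a<n n<b with All.all? Supported? (conjuncts φ)
  ... | yes sup  = All.map (λ inside → proj₂ inside n a<n n<b) (fits sup)
  ... | no unsup = ⊥-elim (proj₂ (vacuous unsup) n a<n n<b)

  slab⊆Supported : ∀ {s x} → slab 𝕊 s x → Supported x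
  slab⊆Supported (_ , _ , refl , A∈) = D⊆Σ A∈

  tlab⊆InΣ⊥ : ∀ {j k} (τ : STrans M j k) → tlab 𝕊 τ ⊆L InΣ⊥ Sig
  tlab⊆InΣ⊥ (fwd _) x = proj₁
  tlab⊆InΣ⊥ loop    x = λ l → l

  tlab-saturated : ∀ {j k} (τ : STrans M j k) → tlab 𝕊 τ nothing → InΣ⊥ Sig ⊆L tlab 𝕊 τ
  tlab-saturated (fwd _) (_ , empty) x x∈Σ = x∈Σ , λ n j<n n<k → ⊥-elim (empty n j<n n<k)
  tlab-saturated loop    _           x x∈Σ = x∈Σ

  Fits-sink : ∀ φ → Fits φ (InΣ⊥ Sig)
  Fits-sink φ = (λ sup → All.map (λ {x} → Supported⇒InΣ⊥ {x}) sup) , (λ _ → tt)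

  toℕ≤sink : ∀ (s : St) → toℕ s ≤ toℕ top
  toℕ≤sink s = subst (toℕ s ≤_) (sym toℕ-top) (Fin.toℕ≤pred[n] s)

  top≰M : ¬ toℕ top ≤ M
  top≰M top≤M = ℕ.1+n≰n (subst (_≤ M) toℕ-top top≤M)

  transition-to-clamp : ∀ {φ s t m} → UFree φ → Tracks s t → t < m →
                        (∀ k → t < k → k < m → Sat minimal k φ) →
                        Σ[ τ ∈ STrans M s (clamp m) ] Fits φ (tlab 𝕊 τ)
  transition-to-clamp {φ} {s} {m = m} u (early refl t≤M) t<m inside =
    fwd (proj₁ bounds) ,
    Fits-Between⁺ {φ} λ n s<n n<c → All.map TrueAt-minimal
                                  (Sat-UFree⁻ u (inside n s<n (ℕ.<-≤-trans n<c (proj₂ bounds))))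
    where
    bounds : toℕ s < toℕ (clamp m) × toℕ (clamp m) ≤ m
    bounds with tracks-clamp m
    ... | early c≡m _  = subst (toℕ s <_) (sym c≡m) t<m , ℕ.≤-reflexive c≡m
    ... | late c≡top M<m =
      let c≡1+M = trans (cong toℕ c≡top) toℕ-top
      in subst (toℕ s <_) (sym c≡1+M) (s≤s t≤M) , subst (_≤ m) (sym c≡1+M) M<m
  transition-to-clamp {φ} {m = m} u (late refl M<t) t<m inside with tracks-clamp m
  ... | early _ m≤M    = contradiction (ℕ.<-trans M<t t<m) (ℕ.≤⇒≯ m≤M)
  ... | late c≡top _   =
    subst (λ c → Σ[ τ ∈ STrans M top c ] Fits φ (tlab 𝕊 τ)) (sym c≡top) (loop , Fits-sink φ)

  Sat⇒Holds : ∀ {κ s t} → InQUs κ → Sat minimal t κ → Tracks s t → Holds 𝕊 s κ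
  Sat⇒Holds (atom A) w (early refl t≤M) = t≤M , A , refl , minimal-true w
  Sat⇒Holds (atom A) w (late _ M<t)     = contradiction (∈⇒≤maxD D (minimal-true w)) (ℕ.<⇒≱ M<t)
  Sat⇒Holds tt       _         _        = tt
  Sat⇒Holds (q ∧ q') (w , w')  tr       = Sat⇒Holds q w tr , Sat⇒Holds q' w' tr
  Sat⇒Holds (u U q)  (m , t<m , wψ , wφ) tr =
    let τ , fits = transition-to-clamp u tr t<m wφ
    in clamp m , τ , fits , Sat⇒Holds q wψ (tracks-clamp m)

  transition⇒Sat : ∀ {I φ s s' t} → Model I → UFree φ → (τ : STrans M s s') → Fits φ (tlab 𝕊 τ) →
                   Tracks s t → ∃[ m ] (t < m × Tracks s' m × (∀ k → t < k → k < m → Sat I k φ))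
  transition⇒Sat {φ = φ} model u (fwd s<s') fits (early refl _) =
    _ , s<s' , tracks-toℕ _ ,
    λ k s<k k<s' → Sat-UFree⁺ u (All.map (HasFact⇒TrueAt model) (Fits-Between⁻ {φ} fits s<k k<s'))
  transition⇒Sat {s' = s'} model u (fwd top<s') fits (late refl _) =
    contradiction (toℕ≤sink s') (ℕ.<⇒≱ top<s')
  transition⇒Sat model u loop fits (early top≡t t≤M) =
    contradiction (subst (_≤ M) (sym top≡t) t≤M) top≰M
  transition⇒Sat model u loop fits (late _ M<t) =
    suc _ , ℕ.n<1+n _ , late refl (ℕ.<-trans M<t (ℕ.n<1+n _)) ,
    λ k t<k k<1+t → contradiction (ℕ.≤-pred k<1+t) (ℕ.<⇒≱ t<k)

  Holds⇒Sat : ∀ {I κ s t} → Model I → InQUs κ → Holds 𝕊 s κ → Tracks s t → Sat I t κ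
  Holds⇒Sat model (atom A) (_ , _ , refl , A∈) (early refl _) = model A _ A∈
  Holds⇒Sat model (atom A) (top≤M , _)         (late refl _)  = contradiction top≤M top≰M
  Holds⇒Sat model tt       _         _                        = tt
  Holds⇒Sat model (q ∧ q') (w , w')  tr = Holds⇒Sat model q w tr , Holds⇒Sat model q' w' tr
  Holds⇒Sat model (u U q)  (s' , τ , fits , w) tr =
    let m , t<m , tr' , inside = transition⇒Sat model u τ fits tr
    in m , t<m , Holds⇒Sat model q w tr' , inside

  ⊨0⇔Holds : ∀ {κ} → InQUs κ → (D ⊨0 κ) ⇔ Holds 𝕊 Fin.zero κ
  ⊨0⇔Holds q = mk⇔ (λ ent → Sat⇒Holds q (ent minimal minimal-model) (early refl z≤n))
                   (λ w I model → Holds⇒Sat model q w (early refl z≤n))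

  InΣ⊥? : Decidable (InΣ⊥ Sig)
  InΣ⊥? nothing  = yes tt
  InΣ⊥? (just A) = Sig? A

  HasFact? : ∀ x n → Dec (HasFact D x n)
  HasFact? nothing  n = no λ ()
  HasFact? (just A) n = (A , n) ∈? D

  slab? : ∀ s x → Dec (slab 𝕊 s x)
  slab? s nothing  = no λ { (_ , _ , () , _) }
  slab? s (just A) =
    map′ (λ (s≤M , A∈) → s≤M , A , refl , A∈) (λ { (s≤M , _ , refl , A∈) → s≤M , A∈ })
         (toℕ s ≤? M ×-dec (A , toℕ s) ∈? D)

  tlab? : ∀ {j k} (τ : STrans M j k) x → Dec (tlab 𝕊 τ x)
  tlab? (fwd _) x = InΣ⊥? x ×-dec ∀-between? (HasFact D x) (HasFact? x) _ _
  tlab? loop    x = InΣ⊥? x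

  STrans? : ∀ j k → Dec (STrans M j k)
  STrans? j k with toℕ j <? toℕ k
  ... | yes j<k = yes (fwd j<k)
  ... | no j≮k with j Fin.≟ top | k Fin.≟ top
  ...   | yes refl | yes refl = yes loop
  ...   | no j≢top | _        = no λ { (fwd j<k) → j≮k j<k ; loop → j≢top refl }
  ...   | yes _    | no k≢top = no λ { (fwd j<k) → j≮k j<k ; loop → k≢top refl }

  tlab-irrelevant : ∀ {j k} (τ τ' : STrans M j k) → tlab 𝕊 τ ⊆L tlab 𝕊 τ'
  tlab-irrelevant (fwd _)       (fwd _)       x l = l
  tlab-irrelevant loop          loop          x l = l
  tlab-irrelevant (fwd top<top) loop          x l = ⊥-elim (ℕ.<-irrefl refl top<top)
  tlab-irrelevant loop          (fwd top<top) x l = ⊥-elim (ℕ.<-irrefl refl top<top)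

  Fits? : ∀ φ {L} → Decidable L → Dec (Fits φ L)
  Fits? φ L? = (supported? →-dec All.all? L? (conjuncts φ)) ×-dec (¬? supported? →-dec L? nothing)
    where supported? = All.all? Supported? (conjuncts φ)

  Holds? : ∀ s κ → Dec (Holds 𝕊 s κ)
  Holds? s (atom A) = slab? s (just A)
  Holds? s tt       = yes tt
  Holds? s ff       = no λ ()
  Holds? s (φ ∧ ψ)  = Holds? s φ ×-dec Holds? s ψ
  Holds? s (φ U ψ)  = Fin.any? step?
    where
    step? : ∀ s' → Dec (Σ[ τ ∈ STrans M s s' ] (Fits φ (tlab 𝕊 τ) × Holds 𝕊 s' ψ))
    step? s' with STrans? s s'
    ... | no ¬τ = no (¬τ ∘ proj₁)
    ... | yes τ = map′ (τ ,_) (λ (τ' , fits , w) → Fits-mono φ (tlab-irrelevant τ' τ) fits , w)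
                       (Fits? φ (tlab? τ) ×-dec Holds? s' ψ)

  ⊨0? : ∀ {κ} → InQUs κ → Dec (D ⊨0 κ)
  ⊨0? {κ} q = map′ (Equivalence.from (⊨0⇔Holds q)) (Equivalence.to (⊨0⇔Holds q)) (Holds? Fin.zero κ)

  successor : ∀ s → ∃[ s' ] STrans M s s'
  successor s with tracks-toℕ s
  ... | early _ s≤M = top , fwd (subst (toℕ s <_) (sym toℕ-top) (s≤s s≤M))
  ... | late refl _ = top , loop

module Separation (l m : ℕ) (Epos : Fin (suc l) → Instance) (Eneg : Fin m → Instance) where

  Sig : Atom → Set
  Sig = SigmaE Epos Eneg

  open Semantics Sig

  atomsΣ : List Atom
  atomsΣ = atomsOf Epos ++ atomsOf Eneg

  ∈atomsΣ⇔ : ∀ {A} → A ∈ atomsΣ ⇔ Sig A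
  ∈atomsΣ⇔ = mk⇔ to from
    where
    to : ∀ {A} → A ∈ atomsΣ → Sig A
    to A∈ with ∈-++⁻ (atomsOf Epos) A∈
    ... | inj₁ A∈pos = inj₁ (∈atomsOf⁻ Epos A∈pos)
    ... | inj₂ A∈neg = inj₂ (∈atomsOf⁻ Eneg A∈neg)
    from : ∀ {A} → Sig A → A ∈ atomsΣ
    from (inj₁ (_ , _ , A∈)) = ∈-++⁺ˡ (∈atomsOf⁺ Epos A∈)
    from (inj₂ (_ , _ , A∈)) = ∈-++⁺ʳ (atomsOf Epos) (∈atomsOf⁺ Eneg A∈)

  Sig? : Decidable Sig
  Sig? A = map′ (Equivalence.to ∈atomsΣ⇔) (Equivalence.from ∈atomsΣ⇔) (Any.any? (A ℕ.≟_) atomsΣ)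

  module Pos (i : Fin (suc l)) = InstanceSystem Sig Sig? (Epos i) (λ A∈ → inj₁ (i , _ , A∈))
  module Neg (j : Fin m)       = InstanceSystem Sig Sig? (Eneg j) (λ A∈ → inj₂ (j , _ , A∈))

  𝒫 𝒩 : TS
  𝒫 = 𝔓 Epos Eneg
  𝒩 = 𝔑 Epos Eneg

  Holds-start⇒positives : ∀ {κ s} → InQUs κ → Start 𝒫 s → Holds 𝒫 s κ → ∀ i → Epos i ⊨0 κ
  Holds-start⇒positives {κ} q start w i =
    Equivalence.from (Pos.⊨0⇔Holds i q)
      (subst (λ a → Holds (Pos.𝕊 i) a κ) (start i) (Holds-Product⁻ _ _ κ w i))

  positives⇒Holds : ∀ {κ} → InQUs κ → (∀ i → Epos i ⊨0 κ) → Holds 𝒫 (λ _ → Fin.zero) κ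
  positives⇒Holds {κ} q ents = Holds-Product⁺ _ _ κ λ i → Equivalence.to (Pos.⊨0⇔Holds i q) (ents i)

  Holds-start⇒negative : ∀ {κ u} → InQUs κ → Start 𝒩 u → Holds 𝒩 u κ → Eneg (proj₁ u) ⊨0 κ
  Holds-start⇒negative {κ} {j , _} q refl w =
    Equivalence.from (Neg.⊨0⇔Holds j q) (Holds-DisjUnion⁻ _ j _ κ w)

  -- Finding the negative example constructively is where decidability of entailment is used.
  nonseparable⇒negative : ∀ {Cls : Query → Set} {κ} → (∀ {κ} → Cls κ → InQUs κ) →
                          ¬ Separable Cls Epos Eneg → Cls κ → (∀ i → Epos i ⊨0 κ) →
                          ∃[ j ] Holds 𝒩 (j , Fin.zero) κ
  nonseparable⇒negative {κ = κ} QUs ¬sep c ents with Fin.any? (λ j → Neg.⊨0? j (QUs c))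
  ... | yes (j , ent) = j , Holds-DisjUnion⁺ _ j _ κ (Equivalence.to (Neg.⊨0⇔Holds j (QUs c)) ent)
  ... | no none       = ⊥-elim (¬sep (κ , c , ents , λ j ent → none (j , ent)))

  Start𝒫? : ∀ s → Dec (Start 𝒫 s)
  Start𝒫? s = Fin.all? λ i → s i Fin.≟ Fin.zero

  slab𝒫? : ∀ s → Decidable (slab 𝒫 s)
  slab𝒫? s x = Fin.all? λ i → Pos.slab? i (s i) x

  tlab𝒫? : ∀ {s s'} (t : Trans 𝒫 s s') → Decidable (tlab 𝒫 t)
  tlab𝒫? t x = Fin.all? λ i → Pos.tlab? i (t i) x

  Trans𝒫? : ∀ s s' → Dec (Trans 𝒫 s s')
  Trans𝒫? s s' = Fin.all? λ i → Pos.STrans? i (s i) (s' i)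

  tlab𝒫-irrelevant : ∀ {s s'} (t t' : Trans 𝒫 s s') → tlab 𝒫 t ⊆L tlab 𝒫 t'
  tlab𝒫-irrelevant t t' x l i = Pos.tlab-irrelevant i (t i) (t' i) x (l i)

  Holds𝒩? : ∀ u κ → Dec (Holds 𝒩 u κ)
  Holds𝒩? (j , a) κ = map′ (Holds-DisjUnion⁺ _ j a κ) (Holds-DisjUnion⁻ _ j a κ) (Neg.Holds? j a κ)

  successor𝒩 : ∀ u → ∃[ u' ] Trans 𝒩 u u'
  successor𝒩 (j , a) = let a' , τ = Neg.successor j a in (j , a') , inj j τ

  Saturated : Label → Set
  Saturated L = L nothing → InΣ⊥ Sig ⊆L L

  tlab𝒩-saturated : ∀ {u u'} (t : Trans 𝒩 u u') → Saturated (tlab 𝒩 t)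
  tlab𝒩-saturated (inj j τ) = Neg.tlab-saturated j τ

  elab𝒩-saturated : ∀ {n n'} (e : Edge 𝒩 n n') → Saturated (elab 𝒩 e)
  elab𝒩-saturated (edge _ t) = tlab𝒩-saturated t

  atomsIn : (L : Label) → Decidable L → List Atom
  atomsIn L L? = filter (L? ∘ just) atomsΣ

  ∈atomsIn⁺ : ∀ {L} (L? : Decidable L) {A} → L (just A) → Sig A → A ∈ atomsIn L L?
  ∈atomsIn⁺ L? A∈L A∈Σ = ∈-filter⁺ (L? ∘ just) (Equivalence.from ∈atomsΣ⇔ A∈Σ) A∈L

  ∈atomsIn⁻ : ∀ {L} (L? : Decidable L) {A} → A ∈ atomsIn L L? → L (just A) × Sig A
  ∈atomsIn⁻ L? A∈ = let A∈Σ , A∈L = ∈-filter⁻ (L? ∘ just) {xs = atomsΣ} A∈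
                    in A∈L , Equivalence.to ∈atomsΣ⇔ A∈Σ

  stateQuery : State 𝒫 → Query
  stateQuery s = ⋀ atom (atomsIn (slab 𝒫 s) (slab𝒫? s))

  Holds-stateQuery⇔ : ∀ (S : TS) {u} s → Holds S u (stateQuery s) ⇔ slab 𝒫 s ⊆L slab S u
  Holds-stateQuery⇔ S s = mk⇔ to from
    where
    to : Holds S _ (stateQuery s) → slab 𝒫 s ⊆L slab S _
    to w nothing  l = ⊥-elim (Pos.slab⊆Supported Fin.zero (l Fin.zero))
    to w (just A) l = Holds-⋀⁻ atom _ w
                        (∈atomsIn⁺ (slab𝒫? s) l (Pos.slab⊆Supported Fin.zero (l Fin.zero)))
    from : slab 𝒫 s ⊆L slab S _ → Holds S _ (stateQuery s)
    from sub = Holds-⋀⁺ atom _ λ A∈ → sub _ (proj₁ (∈atomsIn⁻ (slab𝒫? s) A∈))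

  stateQuery-holds : ∀ s → Holds 𝒫 s (stateQuery s)
  stateQuery-holds s = Equivalence.from (Holds-stateQuery⇔ 𝒫 s) (λ _ l → l)

  -- ⊥ when the transition may be taken in one step, the atoms of its label otherwise.
  transQuery : ∀ {s s'} → Trans 𝒫 s s' → Query
  transQuery t with tlab𝒫? t nothing
  ... | yes _ = ff
  ... | no _  = ⋀ atom (atomsIn (tlab 𝒫 t) (tlab𝒫? t))

  IsLambda-transQuery : ∀ {s s'} (t : Trans 𝒫 s s') → IsLambda (transQuery t)
  IsLambda-transQuery t with tlab𝒫? t nothing
  ... | yes _ = ff
  ... | no _  = conj (ConjAtoms-⋀atom _)

  Fits-transQuery : ∀ {s s'} (t : Trans 𝒫 s s') → Fits (transQuery t) (tlab 𝒫 t)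
  Fits-transQuery t with tlab𝒫? t nothing
  ... | yes ⊥∈ = (λ { (() ∷ []) }) , (λ _ → ⊥∈)
  ... | no _   = (λ _ → conjuncts-⋀atom⁺ _ (All.tabulate λ A∈ → proj₁ (∈atomsIn⁻ (tlab𝒫? t) A∈))) ,
                 (λ unsup → ⊥-elim (unsup (conjuncts-⋀atom⁺ _
                                              (All.tabulate λ A∈ → proj₂ (∈atomsIn⁻ (tlab𝒫? t) A∈)))))

  Fits-transQuery⇔ : ∀ {s s'} (t : Trans 𝒫 s s') {L} → Saturated L →
                     Fits (transQuery t) L ⇔ tlab 𝒫 t ⊆L L
  Fits-transQuery⇔ t {L} saturated = mk⇔ to (λ sub → Fits-mono (transQuery t) sub (Fits-transQuery t))
    where
    inΣ : tlab 𝒫 t ⊆L InΣ⊥ Sig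
    inΣ x l = Pos.tlab⊆InΣ⊥ Fin.zero (t Fin.zero) x (l Fin.zero)
    to : Fits (transQuery t) L → tlab 𝒫 t ⊆L L
    to fits with tlab𝒫? t nothing
    to (_ , vacuous) | yes _  = λ x l → saturated (vacuous λ { (() ∷ []) }) x (inΣ x l)
    to (fits , _)    | no ⊥∉ = λ where
      nothing  l → ⊥-elim (⊥∉ l)
      (just A) l → let sup = conjuncts-⋀atom⁺ _ (All.tabulate λ A∈ → proj₂ (∈atomsIn⁻ (tlab𝒫? t) A∈))
                   in All.lookup (conjuncts-⋀atom⁻ _ (fits sup))
                                 (∈atomsIn⁺ (tlab𝒫? t) l (inΣ (just A) l))

  -- Part (ii): Q_p[U]-queries and containment

  pathQuery : ∀ {s} → Run 𝒫 s → Query → Query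
  pathQuery (root _)       κ = κ
  pathQuery (step {s} r t) κ = pathQuery r (stateQuery s ∧ (transQuery t U κ))

  runQuery : ∀ {s} → Run 𝒫 s → Query
  runQuery {s} r = pathQuery r (stateQuery s ∧ tt)

  InQp-pathQuery : ∀ {s κ} (r : Run 𝒫 s) → InQp κ → InQp (pathQuery r κ)
  InQp-pathQuery (root _)       q = q
  InQp-pathQuery (step {s} r t) q =
    InQp-pathQuery r (step (ConjAtoms-⋀atom _) (IsLambda-transQuery t) q)

  InQp-runQuery : ∀ {s} (r : Run 𝒫 s) → InQp (runQuery r)
  InQp-runQuery r = InQp-pathQuery r (last (ConjAtoms-⋀atom _ ∧ tt))

  Holds-pathQuery : ∀ {s κ} (r : Run 𝒫 s) → Holds 𝒫 s κ → Holds 𝒫 (initial r) (pathQuery r κ)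
  Holds-pathQuery (root _)       w = w
  Holds-pathQuery (step {s} r t) w =
    Holds-pathQuery r (stateQuery-holds s , _ , t , Fits-transQuery t , w)

  pathQuery⇒run : ∀ {s κ u} (r : Run 𝒫 s) → Start 𝒩 u → Holds 𝒩 u (pathQuery r (stateQuery s ∧ κ)) →
                  ∃[ u' ] Σ[ r' ∈ Run 𝒩 u' ] (RunLeq 𝒫 𝒩 r r' × Holds 𝒩 u' κ)
  pathQuery⇒run {s} (root _) start (ws , w) =
    _ , root start , root (Equivalence.to (Holds-stateQuery⇔ 𝒩 s) ws) , w
  pathQuery⇒run {s} (step r t) start w with pathQuery⇒run r start w
  ... | _ , r' , r≤r' , (_ , t' , fits , ws , w') =
    _ , step r' t' ,
    step r≤r' (Equivalence.to (Fits-transQuery⇔ t (tlab𝒩-saturated t')) fits)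
              (Equivalence.to (Holds-stateQuery⇔ 𝒩 s) ws) ,
    w'

  run⇒pathQuery : ∀ {s s' κ} {r : Run 𝒫 s} {r' : Run 𝒩 s'} →
                  RunLeq 𝒫 𝒩 r r' → Holds 𝒩 s' κ → Holds 𝒩 (initial r') (pathQuery r κ)
  run⇒pathQuery (root _) w = w
  run⇒pathQuery {r = step r t} {r' = step r' t'} (step r≤r' t≤t' _) w =
    run⇒pathQuery r≤r'
      (Equivalence.from (Holds-stateQuery⇔ 𝒩 _) (RunLeq-end r≤r') , _ , t' ,
       Equivalence.from (Fits-transQuery⇔ t (tlab𝒩-saturated t')) t≤t' , w)

  _⇛_ : Query → Query → Set
  κ ⇛ κ' = ∀ u → Holds 𝒩 u κ → Holds 𝒩 u κ'

  pathQuery-mono : ∀ {s κ κ'} (r : Run 𝒫 s) → κ ⇛ κ' → pathQuery r κ ⇛ pathQuery r κ'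
  pathQuery-mono (root _)   κ⇛κ' = κ⇛κ'
  pathQuery-mono (step r t) κ⇛κ' =
    pathQuery-mono r λ { u (ws , u' , t' , fits , w) → ws , u' , t' , fits , κ⇛κ' u' w }

  -- r₂ extends r along the until-witnesses of κ in 𝔓.
  InQp-realised : ∀ {s κ} → InQp κ → (r : Run 𝒫 s) → Holds 𝒫 s κ →
                  ∃[ s₂ ] Σ[ r₂ ∈ Run 𝒫 s₂ ] (runQuery r₂ ⇛ pathQuery r κ)
  InQp-realised {s} (last c) r w =
    s , r , pathQuery-mono r λ u (ws , _) →
      Holds-ConjAtoms c (Equivalence.to (Holds-stateQuery⇔ 𝒩 s) ws) w
  InQp-realised {s} (step {ρ} {φ} {κ} c _ q) r (wρ , s' , t , fits , w) =
    let s₂ , r₂ , realised = InQp-realised q (step r t) w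
    in s₂ , r₂ , λ u w₂ → pathQuery-mono r first-step u (realised u w₂)
    where
    first-step : (stateQuery s ∧ (transQuery t U κ)) ⇛ (ρ ∧ (φ U κ))
    first-step u (ws , u' , t' , fits' , wκ) =
      Holds-ConjAtoms c (Equivalence.to (Holds-stateQuery⇔ 𝒩 s) ws) wρ , u' , t' ,
      Fits-mono φ (Equivalence.to (Fits-transQuery⇔ t (tlab𝒩-saturated t')) fits') fits ,
      wκ

  nonseparable-Qp⇒contained : ¬ Separable InQp Epos Eneg → ContainedIn 𝒫 𝒩
  nonseparable-Qp⇒contained ¬sep s r =
    let q = InQp-runQuery r
        positive = Holds-start⇒positives (InQp⇒InQUs q) (initial-start r)
                     (Holds-pathQuery r (stateQuery-holds s , tt))
        _ , w = nonseparable⇒negative InQp⇒InQUs ¬sep q positive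
        u' , r' , r≤r' , _ = pathQuery⇒run r refl w
    in u' , r' , r≤r'

  contained⇒nonseparable-Qp : ContainedIn 𝒫 𝒩 → ¬ Separable InQp Epos Eneg
  contained⇒nonseparable-Qp contained (κ , q , ents , rejected) =
    let s₂ , r₂ , realised = InQp-realised q (root λ _ → refl) (positives⇒Holds (InQp⇒InQUs q) ents)
        _ , r' , r₂≤r' = contained s₂ r₂
        end = Equivalence.from (Holds-stateQuery⇔ 𝒩 s₂) (RunLeq-end r₂≤r')
        w = realised (initial r') (run⇒pathQuery r₂≤r' (end , tt))
    in rejected _ (Holds-start⇒negative (InQp⇒InQUs q) (initial-start r') w)

  -- Part (i): Q[U_s]-queries and simulation

  simulated⇒nonseparable-QUs : SimulatedBy 𝒫 𝒩 → ¬ Separable InQUs Epos Eneg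
  simulated⇒nonseparable-QUs simulated (κ , q , ents , rejected) =
    let start : Start 𝒫 (λ _ → Fin.zero)
        start _ = refl
        w   = positives⇒Holds q ents
        hom = simulated (witnessTree 𝒫 start κ w)
        u   = proj₁ (Hom.h hom (_ , root start))
    in rejected (proj₁ u)
         (Holds-start⇒negative q (IsRoot⇒Start (Hom.roots hom (here refl) (isRoot start)))
                                 (Hom-Holds hom (root start) κ w (λ n∈ → n∈)))

  follow : (n : Node 𝒩) (φ ψ : Query) → Dec (Holds 𝒩 (proj₁ n) (φ U ψ)) → Node 𝒩
  follow (u , r) φ ψ (yes (u' , t' , _)) = u' , step r t'
  follow (u , r) φ ψ (no _)              = let u' , t' = successor𝒩 u in u' , step r t'

  follow-edge : ∀ (n : Node 𝒩) φ ψ (d : Dec (Holds 𝒩 (proj₁ n) (φ U ψ))) → Holds 𝒩 (proj₁ n) (φ U ψ) →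
                Σ[ e ∈ Edge 𝒩 n (follow n φ ψ d) ]
                  (Fits φ (elab 𝒩 e) × Holds 𝒩 (proj₁ (follow n φ ψ d)) ψ)
  follow-edge (u , r) φ ψ (yes (u' , t' , fits , w)) _ = edge r t' , fits , w
  follow-edge (u , r) φ ψ (no ¬w)                     w = ⊥-elim (¬w w)

  move : ∀ {s s'} → Dec (Trans 𝒫 s s') → Query → Query
  move (yes t) κ = transQuery t U κ
  move (no _)  κ = tt

  InQUs-move : ∀ {s s' κ} (d : Dec (Trans 𝒫 s s')) → InQUs κ → InQUs (move d κ)
  InQUs-move (yes t) q = IsLambda⇒UFree (IsLambda-transQuery t) U q
  InQUs-move (no _)  q = tt

  Holds-move : ∀ {s s' κ} (d : Dec (Trans 𝒫 s s')) → Holds 𝒫 s' κ → Holds 𝒫 s (move d κ)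
  Holds-move (yes t) w = _ , t , Fits-transQuery t , w
  Holds-move (no _)  w = tt

  move⇒transQuery : ∀ {s s' κ u} (t : Trans 𝒫 s s') (d : Dec (Trans 𝒫 s s')) →
                    Holds 𝒩 u (move d κ) → Holds 𝒩 u (transQuery t U κ)
  move⇒transQuery t (yes t₀) (u' , t' , fits , w) =
    let t₀≤t' = Equivalence.to (Fits-transQuery⇔ t₀ (tlab𝒩-saturated t')) fits
    in u' , t' , Equivalence.from (Fits-transQuery⇔ t (tlab𝒩-saturated t'))
                   (λ x l → t₀≤t' x (tlab𝒫-irrelevant t t₀ x l)) , w
  move⇒transQuery t (no ¬t) _ = ⊥-elim (¬t t)

  -- The unfolding of 𝔓, restricted to the states of T so that it is a finite conjunction.
  module Unfolding (T : FiniteSubtree 𝒫) where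
    open FiniteSubtree T

    states : List (State 𝒫)
    states = map proj₁ nodes

    height : ℕ
    height = max 0 (map (depth ∘ proj₂) nodes)

    depth≤height : ∀ {n} → n ∈ nodes → depth (proj₂ n) ≤ height
    depth≤height n∈ = All.lookup (xs≤max 0 (map (depth ∘ proj₂) nodes)) (∈-map⁺ (depth ∘ proj₂) n∈)

    unfold : ℕ → State 𝒫 → Query
    moves  : ℕ → State 𝒫 → Query
    unfold k s = stateQuery s ∧ moves k s
    moves zero    s = tt
    moves (suc k) s = ⋀ (λ s' → move (Trans𝒫? s s') (unfold k s')) states

    InQUs-unfold : ∀ k s → InQUs (unfold k s)
    InQUs-moves  : ∀ k s → InQUs (moves k s)
    InQUs-unfold k s = UFree⇒InQUs (ConjAtoms⇒UFree (ConjAtoms-⋀atom _)) ∧ InQUs-moves k s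
    InQUs-moves zero    s = tt
    InQUs-moves (suc k) s =
      InQUs-⋀ _ states λ s' → InQUs-move (Trans𝒫? s s') (InQUs-unfold k s')

    Holds-unfold : ∀ k s → Holds 𝒫 s (unfold k s)
    Holds-moves  : ∀ k s → Holds 𝒫 s (moves k s)
    Holds-unfold k s = stateQuery-holds s , Holds-moves k s
    Holds-moves zero    s = tt
    Holds-moves (suc k) s =
      Holds-⋀⁺ _ states λ {s'} _ → Holds-move (Trans𝒫? s s') (Holds-unfold k s')

    roots : List (State 𝒫)
    roots = filter Start𝒫? states

    rootsQuery : Query
    rootsQuery = ⋀ (unfold height) roots

    InQUs-rootsQuery : InQUs rootsQuery
    InQUs-rootsQuery = InQUs-⋀ _ roots (InQUs-unfold height)

    positives-rootsQuery : ∀ i → Epos i ⊨0 rootsQuery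
    positives-rootsQuery i = ⊨0-⋀ _ roots λ {s} s∈ →
      Holds-start⇒positives (InQUs-unfold height s) (proj₂ (∈-filter⁻ Start𝒫? {xs = states} s∈))
                            (Holds-unfold height s) i

    -- A homomorphism of T into 𝔑, read off a negative example satisfying rootsQuery: a node
    -- of depth d is sent to a state satisfying unfold (height ∸ d) of its own state.
    module Image (j : Fin m) (w₀ : Holds 𝒩 (j , Fin.zero) rootsQuery) where

      target : ∀ {s s'} → Run 𝒫 s → Trans 𝒫 s s' → Query
      target {s' = s'} r t = unfold (height ∸ suc (depth r)) s'

      image : ∀ {s} → Run 𝒫 s → Node 𝒩
      image (root _)   = (j , Fin.zero) , root refl
      image (step r t) = follow (image r) (transQuery t) (target r t)
                                (Holds𝒩? (proj₁ (image r)) (transQuery t U target r t))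

      image-holds : ∀ {s} (r : Run 𝒫 s) → (s , r) ∈ nodes →
                    Holds 𝒩 (proj₁ (image r)) (unfold (height ∸ depth r) s)
      next-holds  : ∀ {s s'} (r : Run 𝒫 s) (t : Trans 𝒫 s s') → (s' , step r t) ∈ nodes →
                    Holds 𝒩 (proj₁ (image r)) (transQuery t U target r t)

      image-step : ∀ {s s'} (r : Run 𝒫 s) (t : Trans 𝒫 s s') → (s' , step r t) ∈ nodes →
                   Σ[ e ∈ Edge 𝒩 (image r) (image (step r t)) ]
                     (Fits (transQuery t) (elab 𝒩 e) ×
                      Holds 𝒩 (proj₁ (image (step r t))) (target r t))
      image-step r t n∈ = follow-edge (image r) (transQuery t) (target r t) _ (next-holds r t n∈)

      image-holds (root start) n∈ = Holds-⋀⁻ _ roots w₀ (∈-filter⁺ Start𝒫? (∈-map⁺ proj₁ n∈) start)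
      image-holds (step r t)   n∈ = proj₂ (proj₂ (image-step r t n∈))

      next-holds {s} {s'} r t n∈ =
        let w = subst (λ k → Holds 𝒩 (proj₁ (image r)) (moves k s)) (∸-suc (depth≤height n∈))
                      (proj₂ (image-holds r (prefClosed n∈ (edge r t))))
        in move⇒transQuery t (Trans𝒫? s s') (Holds-⋀⁻ _ states w (∈-map⁺ proj₁ n∈))

      hom : Hom 𝒫 𝒩 T
      hom = record
        { h       = λ n → image (proj₂ n)
        ; roots   = λ { _ (isRoot _) → isRoot refl }
        ; nlabels = λ {n} n∈ → Equivalence.to (Holds-stateQuery⇔ 𝒩 (proj₁ n))
                                                (proj₁ (image-holds (proj₂ n) n∈))
        ; edges   = λ { _ n'∈ (edge r t) →
                        let e , fits , _ = image-step r t n'∈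
                        in e , Equivalence.to (Fits-transQuery⇔ t (elab𝒩-saturated e)) fits }
        }

  nonseparable-QUs⇒simulated : ¬ Separable InQUs Epos Eneg → SimulatedBy 𝒫 𝒩
  nonseparable-QUs⇒simulated ¬sep T =
    let open Unfolding T
        j , w₀ = nonseparable⇒negative (λ q → q) ¬sep InQUs-rootsQuery positives-rootsQuery
    in Image.hom j w₀

theorem3 : ∀ (l m : ℕ) (Epos : Fin (suc l) → Instance) (Eneg : Fin m → Instance) →
    ((¬ Separable InQUs Epos Eneg) ⇔ SimulatedBy (𝔓 Epos Eneg) (𝔑 Epos Eneg))
    × ((¬ Separable InQp Epos Eneg) ⇔ ContainedIn (𝔓 Epos Eneg) (𝔑 Epos Eneg))
theorem3 l m Epos Eneg =
  mk⇔ nonseparable-QUs⇒simulated simulated⇒nonseparable-QUs ,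
  mk⇔ nonseparable-Qp⇒contained contained⇒nonseparable-Qp
  where open Separation l m Epos Eneg
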